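{- For every positive integer $n$, \[ \mathrm{MOF}(K_n) \geq \frac{3n-9}{4}. \]
   Context: An orientation of a simple graph $G$ assigns to each edge $\{u,v\}$ exactly one of the arcs $(u,v)$ or $(v,u)$; if $(u,v)$ is an arc, $v$ is an out-neighbor of $u$. Oriented forcing: given an orientation $D$ and a set $S$ of initially colored vertices, any colored vertex having at most $1$ non-colored out-neighbor forces that out-neighbor to become colored; this rule is applied iteratively as long as possible. $S$ is a forcing set of $D$ if at the end every vertex is colored. $F(D)$ is the minimum size of a forcing set of $D$, and $\mathrm{MOF}(G)$ is the maximum of $F(D)$ over all orientations $D$ of $G$. $K_n$ is the complete graph on $n$ vertices. -}

module Defs where

open import Data.Nat using (ℕ)
open import Data.Fin using (Fin)
open import Data.Bool using (Bool; true; false; not)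
open import Data.Fin.Subset using (Subset; _∈_)
open import Relation.Binary.PropositionalEquality using (_≡_; _≢_)

-- An orientation of the complete graph K_n on vertex set Fin n:
-- arc u v ≡ true means (u,v) is an arc (v is an out-neighbor of u).
record OrientationK (n : ℕ) : Set where
  field
    arc       : Fin n → Fin n → Bool
    irrefl    : ∀ u → arc u u ≡ false
    exactlyOne : ∀ u v → u ≢ v → arc v u ≡ not (arc u v)
open OrientationK public

data Colored {n : ℕ} (D : OrientationK n) (S : Subset n) : Fin n → Set where
  initial : ∀ {v} → v ∈ S → Colored D S v
  force   : ∀ {u v} → Colored D S u → arc D u v ≡ true →
            (∀ w → arc D u w ≡ true → w ≢ v → Colored D S w) →
            Colored D S v

IsForcingSet : {n : ℕ} → OrientationK n → Subset n → Set
IsForcingSet D S = ∀ v → Colored D S v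

module Submission where

-- We build tournaments D_n recursively: D_{n+4} is D_n with a four-vertex
-- gadget q0,q1,q2,q3 attached (see 'gadget'), and D_0,…,D_3 are arbitrary
-- (transitive) tournaments.  A set S cannot be a forcing set as soon as it
-- lies inside a *closed* set C (no vertex of C has exactly one uncoloured
-- out-neighbour, so no force ever leaves C) that misses at least two
-- vertices; call such an S *stuck*.  The heart of the proof is an invariant
-- with a threshold t_n ≈ 3n/4 ('Invariant'): every S with |S| + 3 ≤ t_n is
-- stuck, and every S with |S| + 2 = t_n is stuck or *loose* (each vertex of
-- S has an uncoloured out-neighbour and two vertices are uncoloured).  Adding
-- a gadget raises the threshold by 3 ('extend-invariant'): every colouring of
-- the gadget either exhibits a closed set directly or reduces to the
-- invariant for D_n.  Hence every forcing set of D_n has |S| + 2 ≥ t_n, and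
-- the arithmetic bound 3n ≤ 4 t_n + 1 yields 3n ≤ 4|S| + 9.

open import Defs
open import Data.Nat using (ℕ; zero; suc; _+_; _*_; _≤_; _<_; z≤n; s≤s)
open import Data.Fin.Subset using (Subset; ∣_∣)
open import Data.Nat.Properties
  using (≤-refl; ≤-reflexive; <⇒≤; ≤-pred; ≰⇒>; _≤?_; m≤n⇒m<n∨m≡n; m≤n⇒m≤1+n; m≤m+n;
         +-cancelˡ-≤; +-cancelˡ-≡; +-monoʳ-≤; +-monoˡ-≤; *-monoʳ-≤; module ≤-Reasoning)
open import Data.Nat.Tactic.RingSolver using (solve-∀)
open import Data.Fin using (Fin)
open import Data.Fin.Properties using (_≟_)
open import Data.Bool using (Bool; true; false; not)
open import Data.Vec using (_∷_; lookup; replicate)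
open import Data.Vec.Properties using ([]=⇒lookup; lookup-replicate)
open import Data.Product using (∃; _×_; _,_; proj₂)
open import Data.Sum using (_⊎_; inj₁; inj₂; [_,_]′; map)
open import Data.Empty using (⊥; ⊥-elim)
open import Function using (_∘_)
open import Relation.Binary.PropositionalEquality using (_≡_; _≢_; refl; sym; trans; cong)
open import Relation.Nullary using (¬_; yes; no)

Arcs : ℕ → Set
Arcs n = Fin n → Fin n → Bool

-- Membership in a colouring C : Subset n, read off by 'lookup' so that it
-- computes on explicit colourings.
In Out : ∀ {n} → Subset n → Fin n → Set
In  C x = lookup C x ≡ true
Out C x = lookup C x ≡ false

in-not-out : ∀ {b : Bool} → b ≡ true → b ≡ false → ⊥
in-not-out i o with trans (sym i) o
... | ()

_⊆_ : ∀ {n} → Subset n → Subset n → Set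
S ⊆ C = ∀ x → In S x → In C x

Escape : ∀ {n} → Arcs n → Subset n → Fin n → Fin n → Set
Escape A C u w = A u w ≡ true × Out C w

data Stalled {n} (A : Arcs n) (C : Subset n) (u : Fin n) : Set where
  noEscape   : (∀ w → A u w ≡ true → In C w) → Stalled A C u
  twoEscapes : ∀ w₁ w₂ → w₁ ≢ w₂ → Escape A C u w₁ → Escape A C u w₂ → Stalled A C u

Closed : ∀ {n} → Arcs n → Subset n → Set
Closed A C = ∀ u → In C u → Stalled A C u

record TwoOutside {n} (C : Subset n) : Set where
  constructor twoOutside
  field
    first second : Fin n
    distinct     : first ≢ second
    first-out    : Out C first
    second-out   : Out C second
open TwoOutside

record Stuck {n} (A : Arcs n) (S : Subset n) : Set where
  constructor stuck
  field
    barrier   : Subset n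
    contains  : S ⊆ barrier
    closed    : Closed A barrier
    uncolored : TwoOutside barrier

Open : ∀ {n} → Arcs n → Subset n → Set
Open A S = ∀ u → In S u → ∃ λ w → Escape A S u w

Loose : ∀ {n} → Arcs n → Subset n → Set
Loose A S = Open A S × TwoOutside S

colored-within : ∀ {n} (D : OrientationK n) {S C : Subset n} →
                 S ⊆ C → Closed (arc D) C → ∀ {v} → Colored D S v → In C v
colored-within D S⊆C closed (initial v∈S) = S⊆C _ ([]=⇒lookup v∈S)
colored-within D S⊆C closed (force {u} {v} cu uv others)
  with closed u (colored-within D S⊆C closed cu)
... | noEscape allIn = allIn v uv
... | twoEscapes w₁ w₂ w₁≢w₂ (uw₁ , w₁-out) (uw₂ , w₂-out) with w₁ ≟ v
...   | no w₁≢v  = ⊥-elim (in-not-out (colored-within D S⊆C closed (others w₁ uw₁ w₁≢v)) w₁-out)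
...   | yes refl = ⊥-elim (in-not-out (colored-within D S⊆C closed (others w₂ uw₂ (w₁≢w₂ ∘ sym))) w₂-out)

stuck⇒not-forcing : ∀ {n} (D : OrientationK n) {S : Subset n} → Stuck (arc D) S → ¬ IsForcingSet D S
stuck⇒not-forcing D (stuck C S⊆C closed (twoOutside x _ _ x-out _)) forcing =
  in-not-out (colored-within D S⊆C closed (forcing x)) x-out

some-outside : ∀ {n} (S : Subset n) → ∣ S ∣ < n → ∃ λ v → Out S v
some-outside (false ∷ S) _       = Fin.zero , refl
some-outside (true ∷ S) (s≤s h) = let (v , v-out) = some-outside S h in Fin.suc v , v-out

empty-outside : ∀ {n} (S : Subset n) → ∣ S ∣ ≡ 0 → ∀ u → Out S u
empty-outside (false ∷ S) _ Fin.zero    = refl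
empty-outside (false ∷ S) e (Fin.suc u) = empty-outside S e u

record Invariant {n} (A : Arcs n) (a : ℕ) : Set where
  field
    bounded        : a ≤ n
    stuck-below    : ∀ S → 3 + ∣ S ∣ ≤ a → Stuck A S
    stuck-or-loose : ∀ S → 2 + ∣ S ∣ ≡ a → Stuck A S ⊎ Loose A S

  stuck-or-loose-below : ∀ S → 2 + ∣ S ∣ ≤ a → Stuck A S ⊎ Loose A S
  stuck-or-loose-below S h with m≤n⇒m<n∨m≡n h
  ... | inj₁ lt = inj₁ (stuck-below S lt)
  ... | inj₂ eq = stuck-or-loose S eq
open Invariant

invariant-0 : ∀ {n} (A : Arcs n) → Invariant A 0
invariant-0 A = record { bounded = z≤n ; stuck-below = λ _ () ; stuck-or-loose = λ _ () }

invariant-1 : ∀ {n} (A : Arcs (suc n)) → Invariant A 1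
invariant-1 A = record
  { bounded = s≤s z≤n ; stuck-below = λ { _ (s≤s ()) } ; stuck-or-loose = λ _ () }

-- With threshold 2 the only relevant set is ∅, which is vacuously open.
invariant-2 : ∀ {n} (A : Arcs (2 + n)) → Invariant A 2
invariant-2 A = record
  { bounded        = s≤s (s≤s z≤n)
  ; stuck-below    = λ { _ (s≤s (s≤s ())) }
  ; stuck-or-loose = λ S e → let empty = empty-outside S (+-cancelˡ-≡ 2 _ _ e) in
      inj₂ ( (λ u u∈S → ⊥-elim (in-not-out u∈S (empty u)))
           , twoOutside Fin.zero (Fin.suc Fin.zero) (λ ()) (empty _) (empty _))
  }

pattern q0 = Fin.zero
pattern q1 = Fin.suc Fin.zero
pattern q2 = Fin.suc (Fin.suc Fin.zero)
pattern q3 = Fin.suc (Fin.suc (Fin.suc Fin.zero))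
pattern old i = Fin.suc (Fin.suc (Fin.suc (Fin.suc i)))

old-injective : ∀ {n} {i j : Fin n} → _≡_ {A = Fin (4 + n)} (old i) (old j) → i ≡ j
old-injective refl = refl

gadget : ∀ {n} → Arcs n → Arcs (4 + n)
gadget A q1 q0 = true
gadget A q2 q0 = true
gadget A q2 q1 = true
gadget A q3 q0 = true
gadget A q3 q1 = true
gadget A q3 q2 = true
gadget A q0 (old j) = true
gadget A q1 (old j) = true
gadget A (old i) q2 = true
gadget A (old i) q3 = true
gadget A (old i) (old j) = A i j
gadget A _ _ = false

extend : ∀ {n} → OrientationK n → OrientationK (4 + n)
extend {n} D = record { arc = gadget (arc D) ; irrefl = irr ; exactlyOne = one }
  where
  irr : ∀ u → gadget (arc D) u u ≡ false
  irr q0 = refl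
  irr q1 = refl
  irr q2 = refl
  irr q3 = refl
  irr (old i) = irrefl D i
  one : ∀ u v → u ≢ v → gadget (arc D) v u ≡ not (gadget (arc D) u v)
  one (old i) (old j) i≢j = exactlyOne D i j (i≢j ∘ cong (λ k → old k))
  one q0 q0 q0≢q0 = ⊥-elim (q0≢q0 refl)
  one q1 q1 q1≢q1 = ⊥-elim (q1≢q1 refl)
  one q2 q2 q2≢q2 = ⊥-elim (q2≢q2 refl)
  one q3 q3 q3≢q3 = ⊥-elim (q3≢q3 refl)
  one q0 q1 _ = refl
  one q0 q2 _ = refl
  one q0 q3 _ = refl
  one q1 q0 _ = refl
  one q1 q2 _ = refl
  one q1 q3 _ = refl
  one q2 q0 _ = refl
  one q2 q1 _ = refl
  one q2 q3 _ = refl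
  one q3 q0 _ = refl
  one q3 q1 _ = refl
  one q3 q2 _ = refl
  one q0 (old j) _ = refl
  one q1 (old j) _ = refl
  one q2 (old j) _ = refl
  one q3 (old j) _ = refl
  one (old i) q0 _ = refl
  one (old i) q1 _ = refl
  one (old i) q2 _ = refl
  one (old i) q3 _ = refl

via-old : ∀ {n} {A : Arcs n} {C : Subset n} {b0 b1 b2 b3} u →
          (∀ j → gadget A u (old j) ≡ true) → TwoOutside C →
          Stalled (gadget A) (b0 ∷ b1 ∷ b2 ∷ b3 ∷ C) u
via-old u dom (twoOutside x y x≢y x-out y-out) =
  twoEscapes (old x) (old y) (x≢y ∘ old-injective) (dom x , x-out) (dom y , y-out)

q2-stalled : ∀ {n} {A : Arcs n} {C : Subset n} {b2 b3} →
             Stalled (gadget A) (true ∷ true ∷ b2 ∷ b3 ∷ C) q2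
q2-stalled = noEscape λ { q0 _ → refl ; q1 _ → refl ; q2 () ; q3 () ; (old j) () }

lift-stalled : ∀ {n} {A : Arcs n} {C : Subset n} {b0 b1 u} →
               Stalled A C u → Stalled (gadget A) (b0 ∷ b1 ∷ true ∷ true ∷ C) (old u)
lift-stalled (noEscape allIn) =
  noEscape λ { q0 () ; q1 () ; q2 _ → refl ; q3 _ → refl ; (old j) uj → allIn j uj }
lift-stalled (twoEscapes w₁ w₂ w₁≢w₂ e₁ e₂) =
  twoEscapes (old w₁) (old w₂) (w₁≢w₂ ∘ old-injective) e₁ e₂

module _ {n} (A : Arcs n) where

  stuck-without-q0q1 : ∀ {b2 b3} S → Stuck (gadget A) (false ∷ false ∷ b2 ∷ b3 ∷ S)
  stuck-without-q0q1 S =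
    stuck (false ∷ false ∷ true ∷ true ∷ replicate n true) contains closed
          (twoOutside q0 q1 (λ ()) refl refl)
    where
    contains : (false ∷ false ∷ _ ∷ _ ∷ S) ⊆ (false ∷ false ∷ true ∷ true ∷ replicate n true)
    contains q0 ()
    contains q1 ()
    contains q2 _ = refl
    contains q3 _ = refl
    contains (old i) _ = lookup-replicate i true
    closed : Closed (gadget A) (false ∷ false ∷ true ∷ true ∷ replicate n true)
    closed q0 ()
    closed q1 ()
    closed q2 _ = twoEscapes q0 q1 (λ ()) (refl , refl) (refl , refl)
    closed q3 _ = twoEscapes q0 q1 (λ ()) (refl , refl) (refl , refl)
    closed (old i) _ =
      noEscape λ { q0 () ; q1 () ; q2 _ → refl ; q3 _ → refl ; (old j) _ → lookup-replicate j true }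

  stuck-without-q2q3 : ∀ {b0 b1} S → Stuck (gadget A) (b0 ∷ b1 ∷ false ∷ false ∷ S)
  stuck-without-q2q3 S =
    stuck (true ∷ true ∷ false ∷ false ∷ replicate n true) contains closed
          (twoOutside q2 q3 (λ ()) refl refl)
    where
    contains : (_ ∷ _ ∷ false ∷ false ∷ S) ⊆ (true ∷ true ∷ false ∷ false ∷ replicate n true)
    contains q0 _ = refl
    contains q1 _ = refl
    contains q2 ()
    contains q3 ()
    contains (old i) _ = lookup-replicate i true
    closed : Closed (gadget A) (true ∷ true ∷ false ∷ false ∷ replicate n true)
    closed q0 _ = noEscape λ { (old j) _ → lookup-replicate j true ; q0 () ; q1 () ; q2 () ; q3 () }
    closed q1 _ =
      noEscape λ { q0 _ → refl ; (old j) _ → lookup-replicate j true ; q1 () ; q2 () ; q3 () }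
    closed q2 ()
    closed q3 ()
    closed (old i) _ = twoEscapes q2 q3 (λ ()) (refl , refl) (refl , refl)

  stuck-lift : ∀ {b0 b1 b2 b3 S} → Stuck A S → Stuck (gadget A) (b0 ∷ b1 ∷ b2 ∷ b3 ∷ S)
  stuck-lift {b0} {b1} {b2} {b3} {S} (stuck C S⊆C closedC two@(twoOutside x y x≢y x-out y-out)) =
    stuck (true ∷ true ∷ true ∷ true ∷ C) contains closed
          (twoOutside (old x) (old y) (x≢y ∘ old-injective) x-out y-out)
    where
    contains : (b0 ∷ b1 ∷ b2 ∷ b3 ∷ S) ⊆ (true ∷ true ∷ true ∷ true ∷ C)
    contains q0 _ = refl
    contains q1 _ = refl
    contains q2 _ = refl
    contains q3 _ = refl
    contains (old i) i∈S = S⊆C i i∈S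
    closed : Closed (gadget A) (true ∷ true ∷ true ∷ true ∷ C)
    closed q0 _ = via-old q0 (λ _ → refl) two
    closed q1 _ = via-old q1 (λ _ → refl) two
    closed q2 _ = q2-stalled
    closed q3 _ = noEscape λ { q0 _ → refl ; q1 _ → refl ; q2 _ → refl ; q3 () ; (old j) () }
    closed (old i) i∈C = lift-stalled (closedC i i∈C)

  -- The old vertices escape through an omitted q2 or q3.
  stuck-without-q3 : ∀ {b0 b1 b2 S} → Loose A S → Stuck (gadget A) (b0 ∷ b1 ∷ b2 ∷ false ∷ S)
  stuck-without-q3 {b0} {b1} {b2} {S} (open-S , two) =
    stuck (true ∷ true ∷ true ∷ false ∷ S) contains closed
          (twoOutside q3 (old (first two)) (λ ()) refl (first-out two))
    where
    contains : (b0 ∷ b1 ∷ b2 ∷ false ∷ S) ⊆ (true ∷ true ∷ true ∷ false ∷ S)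
    contains q0 _ = refl
    contains q1 _ = refl
    contains q2 _ = refl
    contains q3 ()
    contains (old i) i∈S = i∈S
    closed : Closed (gadget A) (true ∷ true ∷ true ∷ false ∷ S)
    closed q0 _ = via-old q0 (λ _ → refl) two
    closed q1 _ = via-old q1 (λ _ → refl) two
    closed q2 _ = q2-stalled
    closed q3 ()
    closed (old i) i∈S =
      let (z , iz , z-out) = open-S i i∈S in twoEscapes q3 (old z) (λ ()) (refl , refl) (iz , z-out)

  stuck-without-q1q2 : ∀ {b0 b3 S} → Loose A S → Stuck (gadget A) (b0 ∷ false ∷ false ∷ b3 ∷ S)
  stuck-without-q1q2 {b0} {b3} {S} (open-S , two) =
    stuck (true ∷ false ∷ false ∷ true ∷ S) contains closed (twoOutside q1 q2 (λ ()) refl refl)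
    where
    contains : (b0 ∷ false ∷ false ∷ b3 ∷ S) ⊆ (true ∷ false ∷ false ∷ true ∷ S)
    contains q0 _ = refl
    contains q1 ()
    contains q2 ()
    contains q3 _ = refl
    contains (old i) i∈S = i∈S
    closed : Closed (gadget A) (true ∷ false ∷ false ∷ true ∷ S)
    closed q0 _ = via-old q0 (λ _ → refl) two
    closed q1 ()
    closed q2 ()
    closed q3 _ = twoEscapes q1 q2 (λ ()) (refl , refl) (refl , refl)
    closed (old i) i∈S =
      let (z , iz , z-out) = open-S i i∈S in twoEscapes q2 (old z) (λ ()) (refl , refl) (iz , z-out)

  stuck-without-q0q2 : ∀ {b1 b3 S} → Loose A S → Stuck (gadget A) (false ∷ b1 ∷ false ∷ b3 ∷ S)
  stuck-without-q0q2 {b1} {b3} {S} (open-S , two) =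
    stuck (false ∷ true ∷ false ∷ true ∷ S) contains closed (twoOutside q0 q2 (λ ()) refl refl)
    where
    contains : (false ∷ b1 ∷ false ∷ b3 ∷ S) ⊆ (false ∷ true ∷ false ∷ true ∷ S)
    contains q0 ()
    contains q1 _ = refl
    contains q2 ()
    contains q3 _ = refl
    contains (old i) i∈S = i∈S
    closed : Closed (gadget A) (false ∷ true ∷ false ∷ true ∷ S)
    closed q0 ()
    closed q1 _ = twoEscapes q0 (old (first two)) (λ ()) (refl , refl) (refl , first-out two)
    closed q2 ()
    closed q3 _ = twoEscapes q0 q2 (λ ()) (refl , refl) (refl , refl)
    closed (old i) i∈S =
      let (z , iz , z-out) = open-S i i∈S in twoEscapes q2 (old z) (λ ()) (refl , refl) (iz , z-out)

  loose-without-q1q3 : ∀ {S v} → Out S v → Loose (gadget A) (true ∷ false ∷ true ∷ false ∷ S)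
  loose-without-q1q3 {v = v} v-out = escape , twoOutside q1 q3 (λ ()) refl refl
    where
    escape : Open (gadget A) (true ∷ false ∷ true ∷ false ∷ _)
    escape q0 _ = old v , refl , v-out
    escape q1 ()
    escape q2 _ = q1 , refl , refl
    escape q3 ()
    escape (old i) _ = q3 , refl , refl

  loose-without-q1q2 : ∀ {S v} → Out S v → Loose (gadget A) (true ∷ false ∷ false ∷ true ∷ S)
  loose-without-q1q2 {v = v} v-out = escape , twoOutside q1 q2 (λ ()) refl refl
    where
    escape : Open (gadget A) (true ∷ false ∷ false ∷ true ∷ _)
    escape q0 _ = old v , refl , v-out
    escape q1 ()
    escape q2 ()
    escape q3 _ = q1 , refl , refl
    escape (old i) _ = q2 , refl , refl

  loose-without-q0q3 : ∀ S → Loose (gadget A) (false ∷ true ∷ true ∷ false ∷ S)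
  loose-without-q0q3 S = escape , twoOutside q0 q3 (λ ()) refl refl
    where
    escape : Open (gadget A) (false ∷ true ∷ true ∷ false ∷ S)
    escape q0 ()
    escape q1 _ = q0 , refl , refl
    escape q2 _ = q0 , refl , refl
    escape q3 ()
    escape (old i) _ = q3 , refl , refl

  loose-without-q0q2 : ∀ S → Loose (gadget A) (false ∷ true ∷ false ∷ true ∷ S)
  loose-without-q0q2 S = escape , twoOutside q0 q2 (λ ()) refl refl
    where
    escape : Open (gadget A) (false ∷ true ∷ false ∷ true ∷ S)
    escape q0 ()
    escape q1 _ = q0 , refl , refl
    escape q2 ()
    escape q3 _ = q0 , refl , refl
    escape (old i) _ = q2 , refl , refl

  loose-without-q2 : ∀ {S v} → Out S v → Loose (gadget A) (true ∷ true ∷ false ∷ true ∷ S)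
  loose-without-q2 {v = v} v-out = escape , twoOutside q2 (old v) (λ ()) refl v-out
    where
    escape : Open (gadget A) (true ∷ true ∷ false ∷ true ∷ _)
    escape q0 _ = old v , refl , v-out
    escape q1 _ = old v , refl , v-out
    escape q2 ()
    escape q3 _ = q2 , refl , refl
    escape (old i) _ = q2 , refl , refl

  loose-without-q1 : ∀ {S v} → Open A S → Out S v → Loose (gadget A) (true ∷ false ∷ true ∷ true ∷ S)
  loose-without-q1 {v = v} open-S v-out = escape , twoOutside q1 (old v) (λ ()) refl v-out
    where
    escape : Open (gadget A) (true ∷ false ∷ true ∷ true ∷ _)
    escape q0 _ = old v , refl , v-out
    escape q1 ()
    escape q2 _ = q1 , refl , refl
    escape q3 _ = q1 , refl , refl
    escape (old i) i∈S = let (z , iz , z-out) = open-S i i∈S in old z , iz , z-out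

  loose-without-q0 : ∀ {S v} → Open A S → Out S v → Loose (gadget A) (false ∷ true ∷ true ∷ true ∷ S)
  loose-without-q0 {v = v} open-S v-out = escape , twoOutside q0 (old v) (λ ()) refl v-out
    where
    escape : Open (gadget A) (false ∷ true ∷ true ∷ true ∷ _)
    escape q0 ()
    escape q1 _ = q0 , refl , refl
    escape q2 _ = q0 , refl , refl
    escape q3 _ = q0 , refl , refl
    escape (old i) i∈S = let (z , iz , z-out) = open-S i i∈S in old z , iz , z-out

  -- The invariant is preserved by the gadget, with the threshold raised by
  -- 3.  Both parts split on the colouring of the gadget: colourings missing
  -- {q0,q1} or {q2,q3} are stuck outright; otherwise the gadget carries
  -- 2, 3 or 4 colours and the old part falls under the invariant for A.
  module _ {a} (inv : Invariant A a) where

    stuck-step : ∀ S → 3 + ∣ S ∣ ≤ 3 + a → Stuck (gadget A) S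
    stuck-step (false ∷ false ∷ _ ∷ _ ∷ S) _ = stuck-without-q0q1 S
    stuck-step (_ ∷ _ ∷ false ∷ false ∷ S) _ = stuck-without-q2q3 S
    stuck-step (true ∷ true ∷ true ∷ true ∷ S) h =
      stuck-lift (stuck-below inv S (<⇒≤ (+-cancelˡ-≤ 3 _ _ h)))
    stuck-step (true ∷ true ∷ true ∷ false ∷ S) h = stuck-lift (stuck-below inv S (+-cancelˡ-≤ 3 _ _ h))
    stuck-step (true ∷ true ∷ false ∷ true ∷ S) h = stuck-lift (stuck-below inv S (+-cancelˡ-≤ 3 _ _ h))
    stuck-step (true ∷ false ∷ true ∷ true ∷ S) h = stuck-lift (stuck-below inv S (+-cancelˡ-≤ 3 _ _ h))
    stuck-step (false ∷ true ∷ true ∷ true ∷ S) h = stuck-lift (stuck-below inv S (+-cancelˡ-≤ 3 _ _ h))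
    stuck-step (true ∷ false ∷ true ∷ false ∷ S) h =
      [ stuck-lift , stuck-without-q3 ]′ (stuck-or-loose-below inv S (+-cancelˡ-≤ 3 _ _ h))
    stuck-step (false ∷ true ∷ true ∷ false ∷ S) h =
      [ stuck-lift , stuck-without-q3 ]′ (stuck-or-loose-below inv S (+-cancelˡ-≤ 3 _ _ h))
    stuck-step (true ∷ false ∷ false ∷ true ∷ S) h =
      [ stuck-lift , stuck-without-q1q2 ]′ (stuck-or-loose-below inv S (+-cancelˡ-≤ 3 _ _ h))
    stuck-step (false ∷ true ∷ false ∷ true ∷ S) h =
      [ stuck-lift , stuck-without-q0q2 ]′ (stuck-or-loose-below inv S (+-cancelˡ-≤ 3 _ _ h))

    -- When the gadget carries two colours in 'loose-step', |S| + 1 = a ≤ n,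
    -- so some old vertex is uncoloured.
    fewer : ∀ (S : Subset n) → 1 + ∣ S ∣ ≡ a → ∣ S ∣ < n
    fewer S e rewrite e = bounded inv

    loose-step : ∀ S → 2 + ∣ S ∣ ≡ 3 + a → Stuck (gadget A) S ⊎ Loose (gadget A) S
    loose-step (false ∷ false ∷ _ ∷ _ ∷ S) _ = inj₁ (stuck-without-q0q1 S)
    loose-step (_ ∷ _ ∷ false ∷ false ∷ S) _ = inj₁ (stuck-without-q2q3 S)
    loose-step (true ∷ true ∷ true ∷ true ∷ S) e =
      inj₁ (stuck-lift (stuck-below inv S (≤-reflexive (+-cancelˡ-≡ 3 _ _ e))))
    loose-step (true ∷ true ∷ true ∷ false ∷ S) e =
      inj₁ ([ stuck-lift , stuck-without-q3 ]′ (stuck-or-loose inv S (+-cancelˡ-≡ 3 _ _ e)))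
    loose-step (true ∷ true ∷ false ∷ true ∷ S) e =
      map stuck-lift (λ (_ , two) → loose-without-q2 (first-out two))
          (stuck-or-loose inv S (+-cancelˡ-≡ 3 _ _ e))
    loose-step (true ∷ false ∷ true ∷ true ∷ S) e =
      map stuck-lift (λ (open-S , two) → loose-without-q1 open-S (first-out two))
          (stuck-or-loose inv S (+-cancelˡ-≡ 3 _ _ e))
    loose-step (false ∷ true ∷ true ∷ true ∷ S) e =
      map stuck-lift (λ (open-S , two) → loose-without-q0 open-S (first-out two))
          (stuck-or-loose inv S (+-cancelˡ-≡ 3 _ _ e))
    loose-step (true ∷ false ∷ true ∷ false ∷ S) e =
      inj₂ (loose-without-q1q3 (proj₂ (some-outside S (fewer S (+-cancelˡ-≡ 3 _ _ e)))))
    loose-step (true ∷ false ∷ false ∷ true ∷ S) e =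
      inj₂ (loose-without-q1q2 (proj₂ (some-outside S (fewer S (+-cancelˡ-≡ 3 _ _ e)))))
    loose-step (false ∷ true ∷ true ∷ false ∷ S) _ = inj₂ (loose-without-q0q3 S)
    loose-step (false ∷ true ∷ false ∷ true ∷ S) _ = inj₂ (loose-without-q0q2 S)

    extend-invariant : Invariant (gadget A) (3 + a)
    extend-invariant = record
      { bounded        = s≤s (s≤s (s≤s (m≤n⇒m≤1+n (bounded inv))))
      ; stuck-below    = stuck-step
      ; stuck-or-loose = loose-step
      }

apex : ∀ {n} → Arcs n → Arcs (suc n)
apex A Fin.zero    (Fin.suc j) = true
apex A (Fin.suc i) (Fin.suc j) = A i j
apex A _           _           = false

transitive : ∀ n → OrientationK n
transitive zero    = record { arc = λ () ; irrefl = λ () ; exactlyOne = λ () }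
transitive (suc n) = record { arc = apex (arc D) ; irrefl = irr ; exactlyOne = one }
  where
  D = transitive n
  irr : ∀ u → apex (arc D) u u ≡ false
  irr Fin.zero    = refl
  irr (Fin.suc i) = irrefl D i
  one : ∀ u v → u ≢ v → apex (arc D) v u ≡ not (apex (arc D) u v)
  one Fin.zero    Fin.zero    0≢0 = ⊥-elim (0≢0 refl)
  one Fin.zero    (Fin.suc j) _   = refl
  one (Fin.suc i) Fin.zero    _   = refl
  one (Fin.suc i) (Fin.suc j) i≢j = exactlyOne D i j (i≢j ∘ cong Fin.suc)

family : ∀ n → OrientationK n
family (suc (suc (suc (suc n)))) = extend (family n)
family n = transitive n

threshold : ℕ → ℕ
threshold 0 = 0
threshold 1 = 1
threshold 2 = 2
threshold 3 = 2
threshold (suc (suc (suc (suc n)))) = 3 + threshold n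

family-invariant : ∀ n → Invariant (arc (family n)) (threshold n)
family-invariant 0 = invariant-0 _
family-invariant 1 = invariant-1 _
family-invariant 2 = invariant-2 _
family-invariant 3 = invariant-2 _
family-invariant (suc (suc (suc (suc n)))) = extend-invariant _ (family-invariant n)

threshold-bound : ∀ n → 3 * n ≤ 4 * threshold n + 1
threshold-bound 0 = z≤n
threshold-bound 1 = m≤m+n 3 2
threshold-bound 2 = m≤m+n 6 3
threshold-bound 3 = ≤-refl
threshold-bound (suc (suc (suc (suc n)))) = begin
  3 * (4 + n)                ≡⟨ expand-left n ⟩
  12 + 3 * n                 ≤⟨ +-monoʳ-≤ 12 (threshold-bound n) ⟩
  12 + (4 * threshold n + 1) ≡⟨ expand-right (threshold n) ⟩
  4 * (3 + threshold n) + 1  ∎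
  where
  open ≤-Reasoning
  expand-left : ∀ m → 3 * (4 + m) ≡ 12 + 3 * m
  expand-left = solve-∀
  expand-right : ∀ t → 12 + (4 * t + 1) ≡ 4 * (3 + t) + 1
  expand-right = solve-∀

forcing-set-size : ∀ n (S : Subset n) → IsForcingSet (family n) S → threshold n ≤ 2 + ∣ S ∣
forcing-set-size n S forcing with 3 + ∣ S ∣ ≤? threshold n
... | yes small = ⊥-elim (stuck⇒not-forcing (family n) (stuck-below (family-invariant n) S small) forcing)
... | no large  = ≤-pred (≰⇒> large)

theorem6 : (n : ℕ) → 1 ≤ n →
    ∃ λ (D : OrientationK n) →
      (S : Subset n) → IsForcingSet D S → 3 * n ≤ 4 * ∣ S ∣ + 9
theorem6 n _ = family n , λ S forcing → begin
  3 * n                      ≤⟨ threshold-bound n ⟩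
  4 * threshold n + 1        ≤⟨ +-monoˡ-≤ 1 (*-monoʳ-≤ 4 (forcing-set-size n S forcing)) ⟩
  4 * (2 + ∣ S ∣) + 1        ≡⟨ expand ∣ S ∣ ⟩
  4 * ∣ S ∣ + 9              ∎
  where
  open ≤-Reasoning
  expand : ∀ m → 4 * (2 + m) + 1 ≡ 4 * m + 9
  expand = solve-∀
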